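{- Let $G=(V,E)$ be a circular-arc graph with no twins and no universal vertices, let $C_1,\ldots,C_k$ be cliques of $G$, and let $M$ be an M-node of the PQM-tree of $G$, with $M \subseteq S$ for the CA-module $S$. Suppose $C_i \in \{C_1,\ldots,C_k\}$ is private for $M$. Then: (1) for every $\{C_1,\ldots,C_k\}$-conformal model $\phi$ of $G$, the letter $C_i$ occurs either in $\phi|M^0$ or in $\phi|M^1$; (2) the clique $C_i$ is private for every M-node $M'$ lying on the path from $M$ to the root $S$ in the modular decomposition tree of $(S,\sim)$; in particular, in every $\{C_1,\ldots,C_k\}$-conformal model $\phi$ of $G$ the letter $C_i$ occurs either in $\phi|S^0$ or in $\phi|S^1$.
   Context: Let $V^*=\{v^0,v^1 : v\in V\}$. A conformal model of $G$ is a circular word $\phi$ over $V^*$ containing each letter exactly once (satisfying the conformality conditions for $G$); for $v\in V$, $\phi(v)$ denotes the chord of the circle joining the points $v^0$ and $v^1$, oriented from $v^0$ to $v^1$, so it has a left side and a right side. Two vertices $u,v$ overlap, written $u\sim v$, if their chords cross (the overlap graph is $(V,\sim)$). The PQM-tree of $G$ provides: a partition of $V$ into CA-modules; for each CA-module $S$ a metachord $(S^0,S^1,<_S)$, where $\{S^0,S^1\}$ is a partition of $S^*=\{u^0,u^1:u\in S\}$ such that for every $u\in S$ exactly one of $u^0,u^1$ lies in $S^0$ and the other in $S^1$, and $<_S$ is a fixed transitive orientation of the non-overlap relation on $S$. In every conformal model $\phi$ of $G$, the letters of $S^j$ ($j\in\{0,1\}$) form a contiguous subword $\phi|S^j$.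 The M-nodes contained in $S$ are the inner nodes of the modular decomposition tree of the graph $(S,\sim)$ (rooted at $S$); for a node $M$ of this tree, $M^j = M^*\cap S^j$ for $j\in\{0,1\}$, and in every conformal model the letters of $M^j$ form a contiguous subword of $\phi|S^j$. A vertex $a\in M$ is $(M^j,M^{1-j})$-oriented if $a^0\in M^j$ and $a^1\in M^{1-j}$. A clique $C_i$ is private for the M-node $M$ if there are two distinct vertices of $C_i\cap M$ with different orientations (one $(M^0,M^1)$-oriented and the other $(M^1,M^0)$-oriented). A $\{C_1,\ldots,C_k\}$-conformal model of $G$ is a circular word $\phi$ over $V^*\cup\{C_1,\ldots,C_k\}$ (each letter once) such that (H1) the restriction $\phi|V^*$ is a conformal model of $G$, and (H2) for every $i\in[k]$ and every $a\in C_i$ the point $\phi(C_i)$ lies on the left side of the chord $\phi(a)$. In such a model, for an M-node (or CA-module) $M$ and $j\in\{0,1\}$, $\phi|M^j$ denotes the shortest contiguous subword of $\phi$ containing all letters of $M^j$ and no letter of $M^{1-j}$. -}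

module Defs where

open import Data.Nat using (ℕ; _<_; _≤_)
open import Data.Fin using (Fin)
open import Data.Fin.Subset using (Subset; _∈_; _∉_; _⊆_; ∣_∣)
open import Data.Bool using (Bool; true; false; not; _xor_)
open import Data.Product using (Σ; ∃; _×_; _,_)
open import Data.Sum using (_⊎_)
open import Data.Empty using (⊥)
open import Relation.Nullary using (¬_)
open import Relation.Binary.PropositionalEquality using (_≡_; _≢_)

record Graph (n : ℕ) : Set₁ where
  field
    E      : Fin n → Fin n → Set
    sym    : ∀ {u v} → E u v → E v u
    irrefl : ∀ {u} → ¬ E u u
open Graph public

module _ {n : ℕ} (G : Graph n) where

  NN : Fin n → Fin n → Set
  NN u w = (w ≡ u) ⊎ E G u w

  NSub : Fin n → Fin n → Set
  NSub u v = ∀ w → NN u w → NN v w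

  NoTwins : Set
  NoTwins = ∀ u v → NSub u v → NSub v u → u ≡ v

  NoUniversal : Set
  NoUniversal = ∀ u → ¬ (∀ w → NN u w)

  -- The four relations between two vertices (Hsu / Krawczyk)
  Contained : Fin n → Fin n → Set
  Contained u v = E G u v × NSub u v

  CoverCond : Fin n → Fin n → Set
  CoverCond u v = (∀ w → NN u w ⊎ NN v w)
                × (∀ w → ¬ NN v w → NSub w u)
                × (∀ w → ¬ NN u w → NSub w v)

  Cover : Fin n → Fin n → Set
  Cover u v = E G u v × ¬ NSub u v × ¬ NSub v u × CoverCond u v

  Overlap : Fin n → Fin n → Set
  Overlap u v = E G u v × ¬ NSub u v × ¬ NSub v u × ¬ CoverCond u v

-- Circular-arc graphs: arcs on a discrete circle ℤ_m, arc (s,e) is the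
-- set of points from s clockwise to e.

OnArc : ℕ → ℕ → ℕ → Set
OnArc p s e = (s ≤ e × s ≤ p × p ≤ e) ⊎ (e < s × (s ≤ p ⊎ p ≤ e))

IsCircularArc : {n : ℕ} → Graph n → Set
IsCircularArc {n} G =
  Σ ℕ λ m → Σ (Fin n → ℕ) λ s → Σ (Fin n → ℕ) λ e →
    (∀ v → s v < m × e v < m) ×
    (∀ u v → u ≢ v →
      (E G u v → ∃ λ p → p < m × OnArc p (s u) (e u) × OnArc p (s v) (e v)) ×
      ((∃ λ p → p < m × OnArc p (s u) (e u) × OnArc p (s v) (e v)) → E G u v))

IsClique : {n : ℕ} → Graph n → Subset n → Set
IsClique {n} G C = ∀ a b → a ∈ C → b ∈ C → a ≢ b → E G a b

-- Circular words, given by injective position maps (reading order =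
-- clockwise).  Cyclic order x → y → z:

Cyc : ℕ → ℕ → ℕ → Set
Cyc x y z = (x < y × y < z) ⊎ (y < z × z < x) ⊎ (z < x × x < y)

Pat4 : ℕ → ℕ → ℕ → ℕ → Set
Pat4 a b c d = Cyc a b c × Cyc a c d

-- Conformality of a word over V* (φ v false = position of v⁰, φ v true = v¹)
Conformal : {n : ℕ} → Graph n → (Fin n → Bool → ℕ) → Set
Conformal {n} G φ = ∀ u v → u ≢ v →
    (¬ E G u v → Pat4 (φ u false) (φ u true) (φ v false) (φ v true))
  × (Contained G u v → Pat4 (φ v false) (φ u false) (φ u true) (φ v true))
  × (Cover G u v → Pat4 (φ u false) (φ v true) (φ v false) (φ u true))
  × (Overlap G u v → Pat4 (φ u false) (φ v false) (φ u true) (φ v true)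
                   ⊎ Pat4 (φ v false) (φ u false) (φ v true) (φ u true))

ConfModel : {n : ℕ} → Graph n → (Fin n → Bool → ℕ) → Set
ConfModel G φ = (∀ u b v c → φ u b ≡ φ v c → (u ≡ v × b ≡ c)) × Conformal G φ

data Letter (n k : ℕ) : Set where
  end : Fin n → Bool → Letter n k
  cl  : Fin k → Letter n k

CModel : {n k : ℕ} → Graph n → (Fin k → Subset n) → (Letter n k → ℕ) → Set
CModel {n} {k} G C φ =
    (∀ x y → φ x ≡ φ y → x ≡ y)
  × Conformal G (λ v b → φ (end v b))
  × (∀ i a → a ∈ C i → Cyc (φ (end a false)) (φ (cl i)) (φ (end a true)))

Contiguous : {n : ℕ} → (Fin n → Bool → ℕ) → (Fin n → Bool → Set) → Set
Contiguous φ X = ∀ x b x' b' y c y' c' → X x b → X x' b' → ¬ X y c → ¬ X y' c'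
  → Cyc (φ x b) (φ y c) (φ x' b') → Cyc (φ x b) (φ x' b') (φ y' c') → ⊥

-- Metachord data: σ u says which endpoint of u lies in S⁰:
-- S⁰ = {u^(σ u)}, S¹ = {u^(not (σ u))}.  For M ⊆ S, Mʲ = M* ∩ Sʲ.

InMj : {n : ℕ} → Subset n → (Fin n → Bool) → Bool → Fin n → Bool → Set
InMj M σ j v b = v ∈ M × b ≡ (σ v xor j)

Oriented : {n : ℕ} → (Fin n → Bool) → Subset n → Bool → Fin n → Set
Oriented σ M j a = InMj M σ j a false × InMj M σ (not j) a true

Private : {n : ℕ} → (Fin n → Bool) → Subset n → Subset n → Set
Private {n} σ M C = Σ (Fin n) λ a → Σ (Fin n) λ b →
  a ∈ C × b ∈ C × a ∈ M × b ∈ M × a ≢ b ×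
  Oriented σ M false a × Oriented σ M true b

InRestr : {n k : ℕ} → (Fin n → Bool) → Subset n → Bool → (Letter n k → ℕ) → Letter n k → Set
InRestr {n} σ M j φ ℓ = Σ (Fin n) λ u → Σ Bool λ b → Σ (Fin n) λ u' → Σ Bool λ b' →
    InMj M σ j u b × InMj M σ j u' b'
  × Cyc (φ (end u b)) (φ ℓ) (φ (end u' b'))
  × (∀ v c → InMj M σ (not j) v c → ¬ Cyc (φ (end u b)) (φ (end v c)) (φ (end u' b')))

module _ {n : ℕ} (G : Graph n) (S : Subset n) where

  IsModule : Subset n → Set
  IsModule X = X ⊆ S × (∀ z x x' → z ∈ S → z ∉ X → x ∈ X → x' ∈ X →
                          Overlap G z x → Overlap G z x')

  IsStrongModule : Subset n → Set
  IsStrongModule X = IsModule X ×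
    (∀ Y → IsModule Y → (∀ x → x ∈ X → x ∈ Y → ⊥) ⊎ X ⊆ Y ⊎ Y ⊆ X)

  -- inner nodes of the modular decomposition tree of (S,∼) = strong
  -- modules with at least two elements
  MNode : Subset n → Set
  MNode M = IsStrongModule M × 2 ≤ ∣ M ∣

-- The letter Cᵢ lies on the left of the chords of every vertex of Cᵢ, in
-- particular of a (M⁰,M¹)-oriented a and a (M¹,M⁰)-oriented b.  The endpoints
-- a⁰, b¹ lie in the block M⁰ and a¹, b⁰ in the block M¹; as both blocks are
-- contiguous, the two chords are arranged so that the intersection of their
-- left sides is an arc between two letters of one block containing no letter
-- of the other.  Privacy is inherited by every larger node, in particular by
-- the CA-module S, which gives the second and third parts.  The hypotheses on
-- G itself enter only through the contiguity of the blocks, which is assumed.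
module Submission where

open import Defs
open import Data.Nat using (ℕ; _<_)
open import Data.Nat.Properties using (<-cmp; <-asym; <-trans; <-irrefl)
open import Data.Fin using (Fin)
open import Data.Fin.Subset using (Subset; _⊆_)
open import Data.Bool using (Bool; true; false; not)
open import Data.Bool.Properties using (not-¬; not-distribʳ-xor)
open import Data.Product using (_×_; _,_; proj₁; uncurry; uncurry′)
open import Data.Sum as Sum using (_⊎_; inj₁; inj₂)
open import Data.Empty using (⊥-elim)
open import Function using (_∘_)
open import Relation.Nullary using (¬_)
open import Relation.Binary using (tri<; tri≈; tri>)
open import Relation.Binary.PropositionalEquality as ≡ using (_≡_; _≢_; refl)

cyc-rotate : ∀ {x y z} → Cyc x y z → Cyc y z x
cyc-rotate (inj₁ p)        = inj₂ (inj₂ p)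
cyc-rotate (inj₂ (inj₁ p)) = inj₁ p
cyc-rotate (inj₂ (inj₂ p)) = inj₂ (inj₁ p)

cyc⇒≢₁₂ : ∀ {x y z} → Cyc x y z → x ≢ y
cyc⇒≢₁₂ (inj₁ (x<y , _))          refl = <-irrefl refl x<y
cyc⇒≢₁₂ (inj₂ (inj₁ (y<z , z<y))) refl = <-asym y<z z<y
cyc⇒≢₁₂ (inj₂ (inj₂ (_ , x<y)))   refl = <-irrefl refl x<y

cyc⇒≢₂₃ : ∀ {x y z} → Cyc x y z → y ≢ z
cyc⇒≢₂₃ c = cyc⇒≢₁₂ (cyc-rotate c)

cyc⇒≢₁₃ : ∀ {x y z} → Cyc x y z → x ≢ z
cyc⇒≢₁₃ c x≡z = cyc⇒≢₁₂ (cyc-rotate (cyc-rotate c)) (≡.sym x≡z)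

cyc-asym : ∀ {x y z} → Cyc x y z → ¬ Cyc x z y
cyc-asym (inj₁ (_ , y<z))        (inj₁ (_ , z<y))        = <-asym y<z z<y
cyc-asym (inj₁ (x<y , _))        (inj₂ (inj₁ (_ , y<x))) = <-asym x<y y<x
cyc-asym (inj₁ (x<y , _))        (inj₂ (inj₂ (y<x , _))) = <-asym x<y y<x
cyc-asym (inj₂ (inj₁ (y<z , _))) (inj₁ (_ , z<y))        = <-asym y<z z<y
cyc-asym (inj₂ (inj₁ (y<z , _))) (inj₂ (inj₁ (z<y , _))) = <-asym y<z z<y
cyc-asym (inj₂ (inj₁ (_ , z<x))) (inj₂ (inj₂ (_ , x<z))) = <-asym z<x x<z
cyc-asym (inj₂ (inj₂ (z<x , _))) (inj₁ (x<z , _))        = <-asym z<x x<z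
cyc-asym (inj₂ (inj₂ (_ , x<y))) (inj₂ (inj₁ (_ , y<x))) = <-asym x<y y<x
cyc-asym (inj₂ (inj₂ (z<x , _))) (inj₂ (inj₂ (_ , x<z))) = <-asym z<x x<z

cyc-total : ∀ {x y z} → x ≢ y → y ≢ z → x ≢ z → Cyc x y z ⊎ Cyc x z y
cyc-total {x} {y} {z} x≢y y≢z x≢z with <-cmp x y | <-cmp y z | <-cmp x z
... | tri≈ _ x≡y _ | _            | _            = ⊥-elim (x≢y x≡y)
... | _            | tri≈ _ y≡z _ | _            = ⊥-elim (y≢z y≡z)
... | _            | _            | tri≈ _ x≡z _ = ⊥-elim (x≢z x≡z)
... | tri< x<y _ _ | tri< y<z _ _ | _            = inj₁ (inj₁ (x<y , y<z))
... | tri< x<y _ _ | tri> _ _ z<y | tri< x<z _ _ = inj₂ (inj₁ (x<z , z<y))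
... | tri< x<y _ _ | tri> _ _ z<y | tri> _ _ z<x = inj₁ (inj₂ (inj₂ (z<x , x<y)))
... | tri> _ _ y<x | tri< y<z _ _ | tri< x<z _ _ = inj₂ (inj₂ (inj₂ (y<x , x<z)))
... | tri> _ _ y<x | tri< y<z _ _ | tri> _ _ z<x = inj₁ (inj₂ (inj₁ (y<z , z<x)))
... | tri> _ _ y<x | tri> _ _ z<y | tri< x<z _ _ = ⊥-elim (<-asym (<-trans z<y y<x) x<z)
... | tri> _ _ y<x | tri> _ _ z<y | tri> _ _ z<x = inj₂ (inj₂ (inj₁ (z<y , y<x)))

¬cyc⇒cyc : ∀ {x y z} → x ≢ y → y ≢ z → x ≢ z → ¬ Cyc x z y → Cyc x y z
¬cyc⇒cyc x≢y y≢z x≢z ¬xzy = Sum.fromInj₁ (⊥-elim ∘ ¬xzy) (cyc-total x≢y y≢z x≢z)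

cyc-trans : ∀ {x y z w} → Cyc x y z → Cyc x z w → Cyc x y w
cyc-trans (inj₁ (x<y , y<z))        (inj₁ (_ , z<w))        = inj₁ (x<y , <-trans y<z z<w)
cyc-trans (inj₁ (x<y , y<z))        (inj₂ (inj₁ (z<w , w<x))) =
  ⊥-elim (<-asym (<-trans x<y (<-trans y<z z<w)) w<x)
cyc-trans (inj₁ (x<y , _))          (inj₂ (inj₂ (w<x , _))) = inj₂ (inj₂ (w<x , x<y))
cyc-trans (inj₂ (inj₁ (_ , z<x)))   (inj₁ (x<z , _))        = ⊥-elim (<-asym z<x x<z)
cyc-trans (inj₂ (inj₁ (y<z , _)))   (inj₂ (inj₁ (z<w , w<x))) =
  inj₂ (inj₁ (<-trans y<z z<w , w<x))
cyc-trans (inj₂ (inj₁ (_ , z<x)))   (inj₂ (inj₂ (_ , x<z))) = ⊥-elim (<-asym z<x x<z)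
cyc-trans (inj₂ (inj₂ (z<x , _)))   (inj₁ (x<z , _))        = ⊥-elim (<-asym z<x x<z)
cyc-trans (inj₂ (inj₂ (_ , x<y)))   (inj₂ (inj₁ (_ , w<x))) = inj₂ (inj₂ (w<x , x<y))
cyc-trans (inj₂ (inj₂ (z<x , _)))   (inj₂ (inj₂ (_ , x<z))) = ⊥-elim (<-asym z<x x<z)

cyc-trans-rotate : ∀ {x y z w} → Cyc x y z → Cyc x z w → Cyc y z w
cyc-trans-rotate xyz xzw =
  cyc-rotate (cyc-rotate (cyc-trans (cyc-rotate xzw) (cyc-rotate (cyc-rotate xyz))))

-- The two ¬ Pat4 hypotheses say that the chords a₀b₁ and a₁b₀ do not cross.
left-sides-meet-between : ∀ {a₀ a₁ b₀ b₁ p} →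
  a₀ ≢ b₀ → a₀ ≢ b₁ → a₁ ≢ b₁ →
  ¬ Pat4 a₀ b₀ b₁ a₁ → ¬ Pat4 a₀ a₁ b₁ b₀ →
  Cyc a₀ p a₁ → Cyc b₀ p b₁ →
  (Cyc a₀ p b₁ × Cyc a₀ b₁ a₁) ⊎ (Cyc b₀ p a₁ × Cyc b₀ a₁ b₁)
left-sides-meet-between {a₀} {a₁} {b₀} {b₁} {p}
  a₀≢b₀ a₀≢b₁ a₁≢b₁ uncrossed₁ uncrossed₂ a₀pa₁ b₀pb₁
  with cyc-total a₀≢b₁ (λ e → a₁≢b₁ (≡.sym e)) (cyc⇒≢₁₃ a₀pa₁)
... | inj₂ a₀a₁b₁ =
  inj₂ (cyc-trans-rotate a₀b₀p a₀pa₁ , cyc-trans-rotate (cyc-trans a₀b₀p a₀pa₁) a₀a₁b₁)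
  where
  a₀b₀b₁ : Cyc a₀ b₀ b₁
  a₀b₀b₁ = ¬cyc⇒cyc a₀≢b₀ (cyc⇒≢₁₃ b₀pb₁) a₀≢b₁
             (λ a₀b₁b₀ → uncrossed₂ (a₀a₁b₁ , a₀b₁b₀))
  a₀b₀p : Cyc a₀ b₀ p
  a₀b₀p = ¬cyc⇒cyc a₀≢b₀ (cyc⇒≢₁₂ b₀pb₁) (cyc⇒≢₁₂ a₀pa₁)
            (λ a₀pb₀ → cyc-asym b₀pb₁ (cyc-rotate (cyc-trans-rotate a₀pb₀ a₀b₀b₁)))
... | inj₁ a₀b₁a₁ with cyc-total (cyc⇒≢₁₂ a₀pa₁) (cyc⇒≢₂₃ b₀pb₁) a₀≢b₁
...   | inj₁ a₀pb₁ = inj₁ (a₀pb₁ , a₀b₁a₁)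
...   | inj₂ a₀b₁p =
  inj₂ (cyc-trans-rotate a₀b₀p a₀pa₁ ,
        cyc-rotate (cyc-trans-rotate a₀b₁b₀ (cyc-trans a₀b₀p a₀pa₁)))
  where
  a₀b₁b₀ : Cyc a₀ b₁ b₀
  a₀b₁b₀ = ¬cyc⇒cyc a₀≢b₁ (λ e → cyc⇒≢₁₃ b₀pb₁ (≡.sym e)) a₀≢b₀
             (λ a₀b₀b₁ → uncrossed₁ (a₀b₀b₁ , a₀b₁a₁))
  a₀b₀p : Cyc a₀ b₀ p
  a₀b₀p = ¬cyc⇒cyc a₀≢b₀ (cyc⇒≢₁₂ b₀pb₁) (cyc⇒≢₁₂ a₀pa₁)
            (λ a₀pb₀ → cyc-asym (cyc-trans-rotate a₀b₁p a₀pb₀)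
                                (cyc-rotate (cyc-rotate b₀pb₁)))

Private-mono : ∀ {n} (σ : Fin n → Bool) {M M' C : Subset n} →
  M ⊆ M' → Private σ M C → Private σ M' C
Private-mono σ M⊆M'
  (a , b , a∈C , b∈C , a∈M , b∈M , a≢b , ((_ , a₀) , (_ , a₁)) , ((_ , b₀) , (_ , b₁))) =
  a , b , a∈C , b∈C , M⊆M' a∈M , M⊆M' b∈M , a≢b ,
  ((M⊆M' a∈M , a₀) , (M⊆M' a∈M , a₁)) , ((M⊆M' b∈M , b₀) , (M⊆M' b∈M , b₁))

CModel⇒ConfModel : ∀ {n k} (G : Graph n) (C : Fin k → Subset n) {φ} →
  CModel G C φ → ConfModel G (λ v c → φ (end v c))
CModel⇒ConfModel G C (inj , conformal , _) =
  (λ u b v c e → end-injective (inj _ _ e)) , conformal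
  where
  end-injective : ∀ {n k u b v c} → end {n} {k} u b ≡ end v c → u ≡ v × b ≡ c
  end-injective refl = refl , refl

module _ {n : ℕ} (T : Subset n) (σ : Fin n → Bool) where

  InMj-disjoint : ∀ {j v c} → InMj T σ (not j) v c → ¬ InMj T σ j v c
  InMj-disjoint {j} {v} (_ , c≡σv⊕¬j) (_ , c≡σv⊕j) =
    not-¬ c≡σv⊕j (≡.trans c≡σv⊕¬j (≡.sym (not-distribʳ-xor (σ v) j)))

  letter-between-in-block : ∀ {k} (φ : Letter n k → ℕ) ℓ {j u b u' b' w c} →
    Contiguous (λ v d → φ (end v d)) (InMj T σ j) →
    InMj T σ j u b → InMj T σ j u' b' → InMj T σ (not j) w c →
    Cyc (φ (end u b)) (φ ℓ) (φ (end u' b')) →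
    Cyc (φ (end u b)) (φ (end u' b')) (φ (end w c)) →
    InRestr σ T j φ ℓ
  letter-between-in-block φ ℓ {u = u} {b} {u'} {b'} {w} {c}
    contiguous ub∈ u'b'∈ wc∈ uℓu' uu'w =
    u , b , u' , b' , ub∈ , u'b'∈ , uℓu' ,
    λ v d vd∈ uvu' →
      contiguous u b u' b' v d w c ub∈ u'b'∈ (InMj-disjoint vd∈) (InMj-disjoint wc∈) uvu' uu'w

  private-clique-letter-in-block : ∀ {k} (G : Graph n) (C : Fin k → Subset n) →
    (∀ j ψ → ConfModel G ψ → Contiguous ψ (InMj T σ j)) →
    ∀ i → Private σ T (C i) →
    ∀ φ → CModel G C φ → InRestr σ T false φ (cl i) ⊎ InRestr σ T true φ (cl i)
  private-clique-letter-in-block G C contiguous i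
    (a , b , a∈C , b∈C , _ , _ , a≢b , (a₀∈T⁰ , a₁∈T¹) , (b₀∈T¹ , b₁∈T⁰))
    φ model@(_ , _ , left-of) =
    Sum.map (uncurry′ (letter-between-in-block φ (cl i) (block false) a₀∈T⁰ b₁∈T⁰ a₁∈T¹))
            (uncurry′ (letter-between-in-block φ (cl i) (block true) b₀∈T¹ a₁∈T¹ b₁∈T⁰))
            (left-sides-meet-between a₀≢b₀ a₀≢b₁ a₁≢b₁ uncrossed₁ uncrossed₂
              (left-of i a a∈C) (left-of i b b∈C))
    where
    ψ : Fin n → Bool → ℕ
    ψ v d = φ (end v d)

    block : ∀ j → Contiguous ψ (InMj T σ j)
    block j = contiguous j ψ (CModel⇒ConfModel G C model)

    ψ-injective : ∀ u d v e → ψ u d ≡ ψ v e → u ≡ v × d ≡ e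
    ψ-injective = proj₁ (CModel⇒ConfModel G C model)

    a₀≢b₀ : ψ a false ≢ ψ b false
    a₀≢b₀ eq = a≢b (proj₁ (ψ-injective _ _ _ _ eq))

    a₁≢b₁ : ψ a true ≢ ψ b true
    a₁≢b₁ eq = a≢b (proj₁ (ψ-injective _ _ _ _ eq))

    a₀≢b₁ : ψ a false ≢ ψ b true
    a₀≢b₁ eq with ψ-injective _ _ _ _ eq
    ... | _ , ()

    uncrossed₁ : ¬ Pat4 (ψ a false) (ψ b false) (ψ b true) (ψ a true)
    uncrossed₁ = uncurry (block false a false b true b false a true a₀∈T⁰ b₁∈T⁰
                            (InMj-disjoint b₀∈T¹) (InMj-disjoint a₁∈T¹))

    uncrossed₂ : ¬ Pat4 (ψ a false) (ψ a true) (ψ b true) (ψ b false)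
    uncrossed₂ = uncurry (block false a false b true a true b false a₀∈T⁰ b₁∈T⁰
                            (InMj-disjoint a₁∈T¹) (InMj-disjoint b₀∈T¹))

mainTheorem1 : {n k : ℕ} (G : Graph n) → IsCircularArc G → NoTwins G → NoUniversal G →
    (C : Fin k → Subset n) → (∀ i → IsClique G (C i)) →
    (S : Subset n) (σ : Fin n → Bool) →
    (∀ j φ → ConfModel G φ → Contiguous φ (InMj S σ j)) →
    (∀ M' → MNode G S M' → ∀ j φ → ConfModel G φ → Contiguous φ (InMj M' σ j)) →
    (M : Subset n) → MNode G S M → (i : Fin k) → Private σ M (C i) →
      (∀ φ → CModel G C φ → InRestr σ M false φ (cl i) ⊎ InRestr σ M true φ (cl i))
    × (∀ M' → MNode G S M' → M ⊆ M' → Private σ M' (C i))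
    × (∀ φ → CModel G C φ → InRestr σ S false φ (cl i) ⊎ InRestr σ S true φ (cl i))
mainTheorem1 G _ _ _ C _ S σ S-contiguous node-contiguous M M-node i private-in-M =
    private-clique-letter-in-block M σ G C (node-contiguous M M-node) i private-in-M
  , (λ M' _ M⊆M' → Private-mono σ M⊆M' private-in-M)
  , private-clique-letter-in-block S σ G C S-contiguous i
      (Private-mono σ M⊆S private-in-M)
  where
  M⊆S : M ⊆ S
  M⊆S = proj₁ (proj₁ (proj₁ M-node))
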